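{- Let $S$ be a numerical semigroup and $n$ a positive integer. Then there exists a numerical semigroup $T$ such that $T^{(2n)}=S$.
   Context: $\mathbb{N}=\{0,1,2,\dots\}$. A numerical set is a subset $S\subseteq\mathbb{N}$ with $0\in S$ and $\mathbb{N}\setminus S$ finite. Its gaps are the elements of $\mathbb{N}\setminus S$, and $F(S)$ is its largest gap. A numerical semigroup is a numerical set closed under addition. For $S\neq\mathbb{N}$, the base is $B(S)=\max\{s\in S\mid s<F(S)\}$. Young diagram of $S$: it has one left-justified row for each gap $\ell$. The top row corresponds to $F(S)$, and the gaps decrease going down. The row for $\ell$ has length $|\{s\in S\mid s<\ell\}|$. This is a bijection between numerical sets and Young diagrams, with $\mathbb{N}$ corresponding to the empty diagram. The complement of a Young diagram with rows $\lambda_1\ge\dots\ge\lambda_g$ has rows $\lambda_1-\lambda_g\ge\dots\ge\lambda_1-\lambda_1$, zero rows being discarded. Geometrically, this is the rest of the $g\times\lambda_1$ rectangle rotated by $180^\circ$. The complement $\widetilde{S}$ is the numerical set whose Young diagram is the complement of that of $S$. One has $\widetilde{\mathbb{N}}=\mathbb{N}$, and for $S\neq\mathbb{N}$ equivalently $\widetilde{S}=\{B(S)-s\mid s\in S,\ s\le B(S)\}\cup\{n\mid n\ge B(S)\}$. Iterated complements: $T^{(0)}=T$ and $T^{(i+1)}=\widetilde{T^{(i)}}$. -}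

module Defs where

open import Data.Bool using (Bool; true; false; if_then_else_; T)
open import Data.Maybe using (Maybe; just; nothing)
open import Data.Nat using (ℕ; zero; suc; _+_; _*_; _∸_; _≤_; _≤ᵇ_)
open import Data.Nat.Properties using (≤⇒≤ᵇ)
open import Data.Unit using (tt)
open import Relation.Binary.PropositionalEquality using (_≡_; refl)

record NumSet : Set where
  field
    mem      : ℕ → Bool
    zero∈    : mem 0 ≡ true
    bound    : ℕ
    cofinite : ∀ n → bound ≤ n → mem n ≡ true
open NumSet public

_∈_ : ℕ → NumSet → Set
n ∈ S = mem S n ≡ true

IsNumericalSemigroup : NumSet → Set
IsNumericalSemigroup S = ∀ a b → a ∈ S → b ∈ S → (a + b) ∈ S

lastGap : (ℕ → Bool) → ℕ → Maybe ℕ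
lastGap f zero    = nothing
lastGap f (suc k) = if f k then lastGap f k else just k

-- largest m < k with f m ≡ true, defaulting to 0
lastIn : (ℕ → Bool) → ℕ → ℕ
lastIn f zero    = 0
lastIn f (suc k) = if f k then k else lastIn f k

lastIn-mem : (f : ℕ → Bool) → f 0 ≡ true → ∀ k → f (lastIn f k) ≡ true
lastIn-mem f p zero = p
lastIn-mem f p (suc k) with f k in eq
... | true  = eq
... | false = lastIn-mem f p k

-- Frobenius number F(S) (largest gap); nothing iff S = ℕ
frobenius : NumSet → Maybe ℕ
frobenius S = lastGap (mem S) (bound S)

baseFrom : NumSet → ℕ → ℕ
baseFrom S F = lastIn (mem S) F

-- membership in the complement for S ≠ ℕ with base B:
-- S̃ = {B - s | s ∈ S, s ≤ B} ∪ {n | n ≥ B}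
complMem : NumSet → ℕ → ℕ → Bool
complMem S B n = if B ≤ᵇ n then true else mem S (B ∸ n)

private
  ifT : ∀ {b : Bool} {x : Bool} → T b → (if b then true else x) ≡ true
  ifT {true} _ = refl

  complZero : (S : NumSet) (B : ℕ) → mem S B ≡ true → complMem S B 0 ≡ true
  complZero S zero    _ = refl
  complZero S (suc B) p = p

complAux : (S : NumSet) → Maybe ℕ → NumSet
complAux S nothing  = S
complAux S (just F) = record
  { mem      = complMem S B
  ; zero∈    = complZero S B (lastIn-mem (mem S) (zero∈ S) F)
  ; bound    = B
  ; cofinite = λ n B≤n → ifT (≤⇒≤ᵇ B≤n)
  }
  where B = baseFrom S F

-- The complement S̃ (ℕ̃ = ℕ)
complement : NumSet → NumSet
complement S = complAux S (frobenius S)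

iterCompl : ℕ → NumSet → NumSet
iterCompl zero    T = T
iterCompl (suc i) T = complement (iterCompl i T)

_≐_ : NumSet → NumSet → Set
S ≐ T = ∀ n → mem S n ≡ mem T n

-- For a numerical set S with all gaps below b, put c = b + 2 and
-- lift S = {0} ∪ (c + (S ∖ {b + 1})).  Its nonzero elements are ≥ c and it
-- contains everything ≥ 2c, so it is a numerical semigroup whatever S is.
-- Its Frobenius number is c + b + 1 with base c + b, so its complement
-- {b − s ∣ s ∈ S, s ≤ b} ∪ [c + b, ∞) has Frobenius number 2b + 1 and base b,
-- and complementing once more reflects back onto S.  Iterating lift n times
-- gives T with T^(2n) = S.
module Submission where

open import Defs
open import Data.Nat using (ℕ; zero; suc; _+_; _*_; _∸_; _≤_; _<_; _≤?_; _<?_; _≟_; z≤n; s≤s; z<s)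
open import Data.Product using (Σ; _×_; _,_)
open import Data.Bool using (Bool; true; false; if_then_else_)
open import Data.Maybe using (Maybe; just; nothing)
open import Data.Nat.GeneralisedArithmetic using (fold)
open import Data.Nat.Properties
open import Data.Sum using (inj₁; inj₂)
open import Function using (case_of_)
open import Relation.Nullary using (does; yes; no; contradiction)
open import Relation.Nullary.Decidable using (dec-true; dec-false)
open import Relation.Binary.PropositionalEquality

lastGap-≡ : ∀ (f : ℕ → Bool) {F k} → f F ≡ false → (∀ n → F < n → f n ≡ true) →
            F < k → lastGap f k ≡ just F
lastGap-≡ f {F} {suc k} fF above (s≤s F≤k) with m≤n⇒m<n∨m≡n F≤k
... | inj₁ F<k rewrite above k F<k = lastGap-≡ f fF above F<k
... | inj₂ refl rewrite fF = refl

lastIn-≡ : ∀ (f : ℕ → Bool) {B k} → f B ≡ true → (∀ n → B < n → n < k → f n ≡ false) →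
           B < k → lastIn f k ≡ B
lastIn-≡ f {B} {suc k} fB between (s≤s B≤k) with m≤n⇒m<n∨m≡n B≤k
... | inj₁ B<k rewrite between k B<k ≤-refl =
  lastIn-≡ f fB (λ n B<n n<k → between n B<n (m≤n⇒m≤1+n n<k)) B<k
... | inj₂ refl rewrite fB = refl

lastGap-cong : ∀ {f g : ℕ → Bool} → (∀ n → f n ≡ g n) → ∀ k → lastGap f k ≡ lastGap g k
lastGap-cong f≗g zero = refl
lastGap-cong f≗g (suc k) rewrite f≗g k | lastGap-cong f≗g k = refl

lastIn-cong : ∀ {f g : ℕ → Bool} → (∀ n → f n ≡ g n) → ∀ k → lastIn f k ≡ lastIn g k
lastIn-cong f≗g zero = refl
lastIn-cong f≗g (suc k) rewrite f≗g k | lastIn-cong f≗g k = refl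

lastGap-extend : ∀ (f : ℕ → Bool) k → (∀ n → k ≤ n → f n ≡ true) →
                 ∀ d → lastGap f (k + d) ≡ lastGap f k
lastGap-extend f k above zero rewrite +-identityʳ k = refl
lastGap-extend f k above (suc d) rewrite +-suc k d | above (k + d) (m≤m+n k d) =
  lastGap-extend f k above d

-- `bound` is not determined by membership, so both scans are first extended to a common length.
frobenius-cong : ∀ {S S′} → S ≐ S′ → frobenius S ≡ frobenius S′
frobenius-cong {S} {S′} S≐S′ = begin
  lastGap (mem S) (bound S)                ≡⟨ lastGap-extend (mem S) (bound S) (cofinite S) (bound S′) ⟨
  lastGap (mem S) (bound S + bound S′)     ≡⟨ lastGap-cong S≐S′ (bound S + bound S′) ⟩
  lastGap (mem S′) (bound S + bound S′)    ≡⟨ cong (lastGap (mem S′)) (+-comm (bound S) (bound S′)) ⟩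
  lastGap (mem S′) (bound S′ + bound S)    ≡⟨ lastGap-extend (mem S′) (bound S′) (cofinite S′) (bound S) ⟩
  lastGap (mem S′) (bound S′)              ∎
  where open ≡-Reasoning

complAux-cong : ∀ {S S′} → S ≐ S′ → ∀ {m m′ : Maybe ℕ} → m ≡ m′ → complAux S m ≐ complAux S′ m′
complAux-cong S≐S′ {nothing} refl = S≐S′
complAux-cong {S} {S′} S≐S′ {just F} refl n
  rewrite lastIn-cong S≐S′ F | S≐S′ (lastIn (mem S′) F ∸ n) = refl

complement-cong : ∀ {S S′} → S ≐ S′ → complement S ≐ complement S′
complement-cong {S} {S′} S≐S′ = complAux-cong {S} {S′} S≐S′ (frobenius-cong {S} {S′} S≐S′)

iterCompl-cong : ∀ i {S S′} → S ≐ S′ → iterCompl i S ≐ iterCompl i S′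
iterCompl-cong zero    S≐S′ = S≐S′
iterCompl-cong (suc i) {S} {S′} S≐S′ =
  complement-cong {iterCompl i S} {iterCompl i S′} (iterCompl-cong i S≐S′)

iterCompl-+ : ∀ i j S → iterCompl (i + j) S ≡ iterCompl i (iterCompl j S)
iterCompl-+ zero    j S = refl
iterCompl-+ (suc i) j S = cong complement (iterCompl-+ i j S)

complMem-≥ : ∀ S {B n} → B ≤ n → complMem S B n ≡ true
complMem-≥ S {B} {n} B≤n rewrite dec-true (B ≤? n) B≤n = refl

complMem-< : ∀ S {B n} → n < B → complMem S B n ≡ mem S (B ∸ n)
complMem-< S {B} {n} n<B rewrite dec-false (B ≤? n) (<⇒≱ n<B) = refl

record FrobeniusBase (S : NumSet) (F B : ℕ) : Set where
  field
    gap-F     : mem S F ≡ false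
    above-F   : ∀ n → F < n → n ∈ S
    B∈S       : B ∈ S
    B<F       : B < F
    between-B : ∀ n → B < n → n < F → mem S n ≡ false

complement-mem : ∀ {S F B} → FrobeniusBase S F B → ∀ n → mem (complement S) n ≡ complMem S B n
complement-mem {S} {F} {B} fb n =
  trans (cong (λ m → mem (complAux S m) n) frobenius-≡) (cong (λ B′ → complMem S B′ n) base-≡)
  where
  open FrobeniusBase fb

  F<bound : F < bound S
  F<bound = ≰⇒> (λ bound≤F → case trans (sym (cofinite S F bound≤F)) gap-F of λ ())

  frobenius-≡ : frobenius S ≡ just F
  frobenius-≡ = lastGap-≡ (mem S) gap-F above-F F<bound

  base-≡ : baseFrom S F ≡ B
  base-≡ = lastIn-≡ (mem S) B∈S between-B B<F

module Lift (S : NumSet) where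
  b c : ℕ
  b = bound S
  c = suc (suc b)

  liftMem : ℕ → Bool
  liftMem k = if does (k <? c) then does (k ≟ 0)
              else if does (k ≟ suc (c + b)) then false
              else mem S (k ∸ c)

  lift-below : ∀ {k} → 0 < k → k < c → liftMem k ≡ false
  lift-below {k} 0<k k<c
    rewrite dec-true (k <? c) k<c | dec-false (k ≟ 0) (>⇒≢ 0<k) = refl

  lift-c+ : ∀ {n} → n ≤ b → liftMem (c + n) ≡ mem S n
  lift-c+ {n} n≤b
    rewrite dec-false (c + n <? c) (m+n≮m c n)
          | dec-false (c + n ≟ suc (c + b)) (<⇒≢ (s≤s (+-monoʳ-≤ c n≤b)))
          | m+n∸m≡n c n = refl

  lift-gap : liftMem (suc (c + b)) ≡ false
  lift-gap
    rewrite dec-false (suc (c + b) <? c) (≤⇒≯ (m≤n⇒m≤1+n (m≤m+n c b)))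
          | dec-true (suc (c + b) ≟ suc (c + b)) refl = refl

  lift-above : ∀ {k} → suc (c + b) < k → liftMem k ≡ true
  lift-above {k} gap<k
    rewrite dec-false (k <? c) (≤⇒≯ (≤-trans (m≤m+n c b) (<⇒≤ (<-trans (n<1+n _) gap<k))))
          | dec-false (k ≟ suc (c + b)) (>⇒≢ gap<k) =
    cofinite S (k ∸ c) b≤k∸c
    where
    b≤k∸c : b ≤ k ∸ c
    b≤k∸c = ≤-trans (≤-reflexive (sym (m+n∸m≡n c b)))
                    (∸-monoˡ-≤ c (<⇒≤ (<-trans (n<1+n _) gap<k)))

  lift-nonzero-≥ : ∀ {k} → liftMem k ≡ true → 0 < k → c ≤ k
  lift-nonzero-≥ k∈ 0<k = ≮⇒≥ (λ k<c → case trans (sym k∈) (lift-below 0<k k<c) of λ ())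

  lift : NumSet
  lift = record { mem = liftMem ; zero∈ = refl ; bound = suc (suc (c + b)) ; cofinite = λ _ → lift-above }

  lift-isNumericalSemigroup : IsNumericalSemigroup lift
  lift-isNumericalSemigroup zero    y       _  y∈ = y∈
  lift-isNumericalSemigroup (suc x) zero    x∈ _  rewrite +-identityʳ x = x∈
  lift-isNumericalSemigroup (suc x) (suc y) x∈ y∈ =
    lift-above {suc x + suc y}
      (≤-trans 2+c+b≤c+c (+-mono-≤ (lift-nonzero-≥ {suc x} x∈ z<s) (lift-nonzero-≥ {suc y} y∈ z<s)))
    where
    2+c+b≤c+c : suc (suc (c + b)) ≤ c + c
    2+c+b≤c+c = ≤-reflexive (sym (trans (+-suc c (suc b)) (cong suc (+-suc c b))))

  lift-frobeniusBase : FrobeniusBase lift (suc (c + b)) (c + b)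
  lift-frobeniusBase = record
    { gap-F     = lift-gap
    ; above-F   = λ _ → lift-above
    ; B∈S       = trans (lift-c+ ≤-refl) (cofinite S b ≤-refl)
    ; B<F       = n<1+n _
    ; between-B = λ n c+b<n n<F → contradiction n<F (≤⇒≯ c+b<n)
    }

  reflected : NumSet
  reflected = complement lift

  reflected-gap : ∀ {n} → b < n → n < c + b → mem reflected n ≡ false
  reflected-gap {n} b<n n<c+b = begin
    mem reflected n          ≡⟨ complement-mem lift-frobeniusBase n ⟩
    complMem lift (c + b) n  ≡⟨ complMem-< lift n<c+b ⟩
    liftMem (c + b ∸ n)      ≡⟨ lift-below (m<n⇒0<n∸m n<c+b) c+b∸n<c ⟩
    false                    ∎
    where
    open ≡-Reasoning
    c+b∸n<c : c + b ∸ n < c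
    c+b∸n<c = subst (c + b ∸ n <_) (m+n∸n≡m c b) (∸-monoʳ-< b<n (<⇒≤ n<c+b))

  reflected-above : ∀ {n} → c + b ≤ n → n ∈ reflected
  reflected-above {n} c+b≤n = trans (complement-mem lift-frobeniusBase n) (complMem-≥ lift c+b≤n)

  reflected-∸ : ∀ {n} → n ≤ b → mem reflected (b ∸ n) ≡ mem S n
  reflected-∸ {n} n≤b = begin
    mem reflected (b ∸ n)          ≡⟨ complement-mem lift-frobeniusBase (b ∸ n) ⟩
    complMem lift (c + b) (b ∸ n)  ≡⟨ complMem-< lift (≤-<-trans (m∸n≤m b n) (m<n+m b z<s)) ⟩
    liftMem (c + b ∸ (b ∸ n))      ≡⟨ cong liftMem (+-∸-assoc c (m∸n≤m b n)) ⟩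
    liftMem (c + (b ∸ (b ∸ n)))    ≡⟨ cong (λ m → liftMem (c + m)) (m∸[m∸n]≡n n≤b) ⟩
    liftMem (c + n)                ≡⟨ lift-c+ n≤b ⟩
    mem S n                        ∎
    where open ≡-Reasoning

  reflected-frobeniusBase : FrobeniusBase reflected (suc (b + b)) b
  reflected-frobeniusBase = record
    { gap-F     = reflected-gap (s≤s (m≤m+n b b)) (n<1+n _)
    ; above-F   = λ _ → reflected-above
    ; B∈S       = trans (reflected-∸ z≤n) (zero∈ S)
    ; B<F       = s≤s (m≤m+n b b)
    ; between-B = λ n b<n n<F → reflected-gap b<n (m<n⇒m<1+n n<F)
    }

  complement²-lift : complement (complement lift) ≐ S
  complement²-lift n = trans (complement-mem reflected-frobeniusBase n) (complMem-reflected n)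
    where
    complMem-reflected : ∀ n → complMem reflected b n ≡ mem S n
    complMem-reflected n with b ≤? n
    ... | yes b≤n = trans (complMem-≥ reflected b≤n) (sym (cofinite S n b≤n))
    ... | no  b≰n = trans (complMem-< reflected (≰⇒> b≰n)) (reflected-∸ (<⇒≤ (≰⇒> b≰n)))

open Lift using (lift; lift-isNumericalSemigroup; complement²-lift)

iterCompl-lift : ∀ k S → iterCompl (2 * k) (fold S lift k) ≐ S
iterCompl-lift zero    S n = refl
iterCompl-lift (suc k) S n = begin
  mem (iterCompl (2 * suc k) (lift U)) n                  ≡⟨ cong (λ T → mem T n) split ⟩
  mem (iterCompl (2 * k) (complement (complement (lift U)))) n
                                                          ≡⟨ iterCompl-cong (2 * k) (complement²-lift U) n ⟩
  mem (iterCompl (2 * k) U) n                             ≡⟨ iterCompl-lift k S n ⟩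
  mem S n                                                 ∎
  where
  open ≡-Reasoning
  U = fold S lift k
  split : iterCompl (2 * suc k) (lift U) ≡ iterCompl (2 * k) (iterCompl 2 (lift U))
  split = trans (cong (λ i → iterCompl i (lift U)) (trans (*-suc 2 k) (+-comm 2 (2 * k))))
                (iterCompl-+ (2 * k) 2 (lift U))

proposition5p7 : (S : NumSet) → IsNumericalSemigroup S → (n : ℕ) → 1 ≤ n →
                   Σ NumSet (λ T → IsNumericalSemigroup T × (iterCompl (2 * n) T ≐ S))
proposition5p7 S _ (suc k) _ =
  fold S lift (suc k) , lift-isNumericalSemigroup (fold S lift k) , iterCompl-lift (suc k) S
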